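{- Let $t, N, d$ be positive integers and suppose there exists a $3$-graph $H$ on vertex set $[N]$ such that (i) every vertex of $H$ has degree at most $d$, and (ii) every $t$-set of vertices of $H$ spans at least one edge of $H$. Then \[c_1\big(K_{t+1}^{(3)}\big)\ge\min\left(1-\frac{1}{N},\ 1-\frac{2d}{N^2}\right).\]
   Context: A $3$-graph is a $3$-uniform hypergraph; $K_t^{(3)}$ is the complete $3$-graph on $t$ vertices. The degree of a vertex is the number of edges containing it. For a $3$-graph $G$, $\delta_1(G)$ is its minimum vertex degree; $G$ has an $F$-covering if every vertex of $G$ lies in a copy of $F$ in $G$. Set $c_1(n,F)=\max\{\delta_1(G): v(G)=n,\ G\text{ has no }F\text{ -covering}\}$ and $c_1(F)=\lim_{n\to\infty}c_1(n,F)/\binom{n-1}{2}$ (this limit exists). -}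

module Defs where

open import Data.Nat using (ℕ; zero; suc; _*_; _∸_; _≤_; NonZero)
open import Data.Nat.Combinatorics using (_C_)
open import Data.Integer using (+_)
open import Data.Rational using (ℚ; _/_; _-_; _⊓_)
import Data.Rational as ℚ
open import Data.Fin using (Fin)
open import Data.Fin.Subset using (Subset; ∣_∣; _⊆_) renaming (_∈_ to _∈ₛ_)
open import Data.Fin.Subset.Properties using (_∈?_)
open import Data.List using (List; length; filter)
open import Data.List.Relation.Unary.All using (All)
open import Data.List.Relation.Unary.Unique.Propositional using (Unique)
open import Data.List.Membership.Propositional using () renaming (_∈_ to _∈ₗ_)
open import Data.Product using (Σ; ∃-syntax; _×_)
open import Relation.Binary.PropositionalEquality using (_≡_)
open import Relation.Nullary using (¬_)

record ThreeGraph (n : ℕ) : Set where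
  field
    edges    : List (Subset n)
    edges-3  : All (λ e → ∣ e ∣ ≡ 3) edges
    distinct : Unique edges
open ThreeGraph public

degree : ∀ {n} → ThreeGraph n → Fin n → ℕ
degree G v = length (filter (v ∈?_) (edges G))

MinDegreeAtLeast : ∀ {n} → ThreeGraph n → ℕ → Set
MinDegreeAtLeast G m = ∀ v → m ≤ degree G v

IsClique : ∀ {n} → ThreeGraph n → Subset n → Set
IsClique G S = ∀ e → ∣ e ∣ ≡ 3 → e ⊆ S → e ∈ₗ edges G

InCopyOfK : ∀ {n} → ℕ → ThreeGraph n → Fin n → Set
InCopyOfK s G v = ∃[ S ] (∣ S ∣ ≡ s × v ∈ₛ S × IsClique G S)

HasKCovering : ∀ {n} → ℕ → ThreeGraph n → Set
HasKCovering s G = ∀ v → InCopyOfK s G v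

SpansEdge : ∀ {n} → ThreeGraph n → Subset n → Set
SpansEdge G S = ∃[ e ] (e ∈ₗ edges G × e ⊆ S)

toℚ : ℕ → ℚ
toℚ m = + m / 1

-- "c₁(n, K_s^{(3)}) ≥ x · binom(n-1,2)": some 3-graph on n vertices has no
-- K_s^{(3)}-covering and every vertex degree is ≥ x · binom(n-1,2)
c₁AtLeast : ℕ → ℕ → ℚ → Set
c₁AtLeast n s x = ∃[ G ] (¬ HasKCovering s G ×
  (∀ (v : Fin n) → x ℚ.* toℚ ((n ∸ 1) C 2) ℚ.≤ toℚ (degree {n} G v)))

-- "c₁(K_s^{(3)}) ≥ α", where c₁(K_s) = lim_n c₁(n,K_s)/binom(n-1,2) (the limit
-- exists): for every rational ε > 0, for all sufficiently large n,
-- c₁(n,K_s) ≥ (α - ε)·binom(n-1,2).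
c₁KAtLeast : ℕ → ℚ → Set
c₁KAtLeast s α = ∀ (ε : ℚ) → ℚ.0ℚ ℚ.< ε →
  ∃[ n₀ ] ∀ n → n₀ ≤ n → c₁AtLeast n s (α - ε)

bound : (N d : ℕ) → .{{NonZero N}} → ℚ
bound (suc m) d = (ℚ.1ℚ - (+ 1 / suc m)) ⊓ (ℚ.1ℚ - (+ (2 * d) / (suc m * suc m)))

-- Blow H up.  Colour the n vertices of a 3-graph G by the vertices of H, each colour being used at most
-- ⌊n/N⌋ + 1 times, and fix a vertex x.  A triple through x is an edge iff its two other vertices have distinct
-- colours; a triple avoiding x is an edge unless its colours form an edge of H.  A K_{t+1} through x would
-- consist of x and t vertices of distinct colours; by (ii) their colours span an edge of H, and the triple of
-- the clique lying over that edge is not an edge of G.  So x lies in no K_{t+1}.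
-- Degrees are counted through the ordered pairs (u, w) completing a vertex to a triple.  At x the missing pairs
-- are the equally coloured ones, about n²/N of them.  At any other vertex v, besides O(n) pairs meeting x or v,
-- the missing pairs are those whose colours form an edge of H with the colour of v, and by (i) there are at
-- most 2d·(n/N + 1)² of them.  Hence every degree is at least min(1 - 1/N, 1 - 2d/N²)·C(n-1, 2) - O(n), and
-- for large n the O(n) is below ε·C(n-1, 2).

module Submission where

open import Data.Bool using (_≟_)
open import Data.Fin as Fin using (Fin; zero; suc; inject≤; remQuot; combine)
open import Data.Fin.Properties using (inject≤-injective; combine-remQuot) renaming (_≟_ to _≟ᶠ_)
import Data.Fin.Properties as Fin
open import Data.Fin.Subset using (Subset; ∣_∣; _∈_; _∉_; _⊆_; _-_; ⁅_⁆; inside; outside)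
open import Data.Fin.Subset.Properties using (_∈?_; ⊆-antisym; p─q⊆p; x∈p∧x≢y⇒x∈p-y)
open import Data.Integer as ℤ using (+_; +≤+; -[1+_]; +[1+_])
import Data.Integer.Properties as ℤP
import Data.Integer.Tactic.RingSolver as ℤ-Solver
open import Data.List
  using (List; []; _∷_; _++_; length; map; filter; allFin; cartesianProduct; cartesianProductWith)
open import Data.List.Properties using (length-map; length-++; length-++-sucʳ; length-tabulate; filter-all)
open import Data.List.Membership.Propositional using () renaming (_∈_ to _∈ₗ_; _∉_ to _∉ₗ_)
open import Data.List.Membership.Propositional.Properties
  using (∈-∃++; ∈-++⁻; ∈-++⁺ˡ; ∈-++⁺ʳ; ∈-map⁺; ∈-map⁻; ∈-filter⁺; ∈-filter⁻; ∈-allFin;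
         ∈-cartesianProduct⁺; ∈-cartesianProductWith⁺)
import Data.List.Membership.DecPropositional as DecMembership
import Data.List.Relation.Binary.Subset.Propositional.Properties as ⊆ₗ
open import Data.List.Relation.Unary.Any as Any using (here; there)
open import Data.List.Relation.Unary.All as All using (All; []; _∷_)
import Data.List.Relation.Unary.All.Properties as All
open import Data.List.Relation.Unary.AllPairs using ([]; _∷_)
open import Data.List.Relation.Unary.Unique.Propositional using (Unique)
import Data.List.Relation.Unary.Unique.Propositional.Properties as Unique
open import Data.Nat as ℕ using (ℕ; zero; suc; _+_; _*_; _≤_; _<_; _⊔_; z≤n; s≤s; NonZero)
open import Data.Nat.Combinatorics using (_C_; nCk+nC[k+1]≡[n+1]C[k+1]; nC1≡n)
open import Data.Nat.DivMod using (_/_; _%_; m≡m%n+[m/n]*n; m%n≤n; m/n*n≤m)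
open import Data.Nat.Properties
  using (suc-injective; <-irrefl; ≤-antisym; ≤-trans; ≤-reflexive; m≤m+n; m≤m*n; m≤n*m; m≤m⊔n; m≤n⊔m;
         +-assoc; +-comm; +-identityʳ; *-comm; *-suc; *-identityˡ; +-mono-≤; +-monoˡ-≤; +-monoʳ-≤;
         *-mono-≤; *-monoˡ-≤; *-monoʳ-≤; +-cancelʳ-≤; *-cancelˡ-≤; module ≤-Reasoning)
open import Data.Nat.Tactic.RingSolver using (solve-∀)
open import Data.Product using (∃-syntax; _×_; _,_; proj₁; proj₂; uncurry)
open import Data.Rational as ℚ using (ℚ; mkℚ; toℚᵘ; 0ℚ; 1ℚ)
import Data.Rational.Properties as ℚP
open import Data.Rational.Unnormalised as ℚᵘ using (mkℚᵘ; *≤*; 1ℚᵘ)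
import Data.Rational.Unnormalised.Properties as ℚᵘP
open import Data.Sum using (_⊎_; inj₁; inj₂; [_,_]′)
open import Data.Vec using ([]; _∷_; here; there; tabulate)
open import Data.Vec.Properties using (≡-dec; ∷-injective; lookup∘tabulate; lookup⇒[]=; []=⇒lookup)
open import Function using (id; _∘_; Injective; case_of_)
open import Level using (0ℓ)
open import Relation.Binary.Definitions using (tri<; tri≈; tri>)
open import Relation.Binary.PropositionalEquality
  using (_≡_; _≢_; ≢-sym; refl; sym; trans; cong; cong₂; subst; subst₂; module ≡-Reasoning)
open import Relation.Nullary using (¬_; ¬?; Dec; yes; no; does; contradiction; _×-dec_)
open import Relation.Nullary.Decidable using (dec-true; map′; _→-dec_)
open import Relation.Unary using (Pred; Decidable; _∪_; _∩_; ∁)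
open import Relation.Unary.Properties using (_∪?_; _∩?_; ∁?)

open import Defs

private
  variable
    X Y : Set
    n : ℕ

-- Counting by injections

module _ (g : X → Y) where

  injectiveOn⇒length≤ : ∀ {xs : List X} {ys : List Y} → Unique xs →
    (∀ {a b} → a ∈ₗ xs → b ∈ₗ xs → g a ≡ g b → a ≡ b) →
    (∀ {a} → a ∈ₗ xs → g a ∈ₗ ys) → length xs ≤ length ys
  injectiveOn⇒length≤ {[]}     _            _   _    = z≤n
  injectiveOn⇒length≤ {x ∷ xs} (x∉xs ∷ !xs) inj into with ∈-∃++ (into (here refl))
  ... | ys₁ , ys₂ , refl = begin
    suc (length xs)            ≤⟨ s≤s (injectiveOn⇒length≤ !xs (λ a∈ b∈ → inj (there a∈) (there b∈)) into′) ⟩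
    suc (length (ys₁ ++ ys₂))  ≡⟨ length-++-sucʳ ys₁ (g x) ys₂ ⟨
    length (ys₁ ++ g x ∷ ys₂)  ∎
    where
    open ≤-Reasoning
    into′ : ∀ {a} → a ∈ₗ xs → g a ∈ₗ ys₁ ++ ys₂
    into′ a∈xs with ∈-++⁻ ys₁ (into (there a∈xs))
    ... | inj₁ ∈ys₁         = ∈-++⁺ˡ ∈ys₁
    ... | inj₂ (here ga≡gx) = contradiction (inj (here refl) (there a∈xs) (sym ga≡gx)) (All.lookup x∉xs a∈xs)
    ... | inj₂ (there ∈ys₂) = ∈-++⁺ʳ ys₁ ∈ys₂

unique⊆⇒length≤ : ∀ {xs ys : List X} → Unique xs → (∀ {a} → a ∈ₗ xs → a ∈ₗ ys) → length xs ≤ length ys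
unique⊆⇒length≤ !xs = injectiveOn⇒length≤ id !xs (λ _ _ → id)

length-cartesianProduct : (xs : List X) (ys : List Y) → length (cartesianProduct xs ys) ≡ length xs * length ys
length-cartesianProduct []       ys = refl
length-cartesianProduct (x ∷ xs) ys =
  trans (length-++ (map (x ,_) ys)) (cong₂ _+_ (length-map (x ,_) ys) (length-cartesianProduct xs ys))

-- Finite subsets, triples and images

elements : Subset n → List (Fin n)
elements []            = []
elements (inside ∷ S)  = zero ∷ map suc (elements S)
elements (outside ∷ S) = map suc (elements S)

length-elements : (S : Subset n) → length (elements S) ≡ ∣ S ∣
length-elements []            = refl
length-elements (inside ∷ S)  = cong suc (trans (length-map suc (elements S)) (length-elements S))
length-elements (outside ∷ S) = trans (length-map suc (elements S)) (length-elements S)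

∈-elements⁺ : ∀ {S : Subset n} {a} → a ∈ S → a ∈ₗ elements S
∈-elements⁺ {S = inside ∷ S}  here       = here refl
∈-elements⁺ {S = inside ∷ S}  (there a∈) = there (∈-map⁺ suc (∈-elements⁺ a∈))
∈-elements⁺ {S = outside ∷ S} (there a∈) = ∈-map⁺ suc (∈-elements⁺ a∈)

∈-elements⁻ : ∀ {S : Subset n} {a} → a ∈ₗ elements S → a ∈ S
∈-elements⁻ {S = inside ∷ S} (here refl) = here
∈-elements⁻ {S = inside ∷ S} (there a∈) with _ , b∈ , refl ← ∈-map⁻ suc a∈ = there (∈-elements⁻ b∈)
∈-elements⁻ {S = outside ∷ S} a∈        with _ , b∈ , refl ← ∈-map⁻ suc a∈ = there (∈-elements⁻ b∈)

elements-unique : (S : Subset n) → Unique (elements S)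
elements-unique []            = []
elements-unique (inside ∷ S)  = zero∉ (elements S) ∷ Unique.map⁺ Fin.suc-injective (elements-unique S)
  where
  zero∉ : (xs : List (Fin n)) → All (Fin.zero ≢_) (map Fin.suc xs)
  zero∉ []       = []
  zero∉ (_ ∷ xs) = (λ ()) ∷ zero∉ xs
elements-unique (outside ∷ S) = Unique.map⁺ Fin.suc-injective (elements-unique S)

∣p∣≤length : ∀ {p : Subset n} {xs} → (∀ {a} → a ∈ p → a ∈ₗ xs) → ∣ p ∣ ≤ length xs
∣p∣≤length {p = p} p⊆xs =
  subst (_≤ _) (length-elements p) (unique⊆⇒length≤ (elements-unique p) (p⊆xs ∘ ∈-elements⁻))

∣p∣≡length : ∀ {p : Subset n} {xs} → Unique xs → (∀ {a} → a ∈ p → a ∈ₗ xs) → (∀ {a} → a ∈ₗ xs → a ∈ p) →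
  ∣ p ∣ ≡ length xs
∣p∣≡length {p = p} !xs p⊆xs xs⊆p = ≤-antisym (∣p∣≤length p⊆xs)
  (subst (_ ≤_) (length-elements p) (unique⊆⇒length≤ !xs (∈-elements⁺ ∘ xs⊆p)))

module _ {n : ℕ} where
  open DecMembership (_≟ᶠ_ {n}) using () renaming (_∈?_ to _∈ₗ?_)

  fromList : List (Fin n) → Subset n
  fromList xs = tabulate (λ a → does (a ∈ₗ? xs))

  ∈-fromList⁻ : ∀ (xs : List (Fin n)) {a} → a ∈ fromList xs → a ∈ₗ xs
  ∈-fromList⁻ xs {a} a∈ with a ∈ₗ? xs | trans (sym (lookup∘tabulate (λ b → does (b ∈ₗ? xs)) a)) ([]=⇒lookup a∈)
  ... | yes a∈xs | _ = a∈xs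
  ... | no _     | ()

  ∈-fromList⁺ : ∀ (xs : List (Fin n)) {a} → a ∈ₗ xs → a ∈ fromList xs
  ∈-fromList⁺ xs {a} a∈xs =
    lookup⇒[]= a _ (trans (lookup∘tabulate (λ b → does (b ∈ₗ? xs)) a) (dec-true (a ∈ₗ? xs) a∈xs))

fromList-cong : ∀ {xs ys : List (Fin n)} → (∀ {a} → a ∈ₗ xs → a ∈ₗ ys) → (∀ {a} → a ∈ₗ ys → a ∈ₗ xs) →
  fromList xs ≡ fromList ys
fromList-cong {xs = xs} {ys} xs⊆ys ys⊆xs =
  ⊆-antisym (∈-fromList⁺ ys ∘ xs⊆ys ∘ ∈-fromList⁻ xs) (∈-fromList⁺ xs ∘ ys⊆xs ∘ ∈-fromList⁻ ys)

fromList-elements : (S : Subset n) → fromList (elements S) ≡ S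
fromList-elements S = ⊆-antisym (∈-elements⁻ ∘ ∈-fromList⁻ (elements S)) (∈-fromList⁺ (elements S) ∘ ∈-elements⁺)

tri : Fin n → Fin n → Fin n → Subset n
tri a b c = fromList (a ∷ b ∷ c ∷ [])

module _ {a b c d : Fin n} where

  ∈-tri⁻ : d ∈ tri a b c → d ≡ a ⊎ d ≡ b ⊎ d ≡ c
  ∈-tri⁻ d∈ with ∈-fromList⁻ (a ∷ b ∷ c ∷ []) d∈
  ... | here d≡a                 = inj₁ d≡a
  ... | there (here d≡b)         = inj₂ (inj₁ d≡b)
  ... | there (there (here d≡c)) = inj₂ (inj₂ d≡c)

  ∈-tri⁺ : d ≡ a ⊎ d ≡ b ⊎ d ≡ c → d ∈ tri a b c
  ∈-tri⁺ (inj₁ d≡a)        = ∈-fromList⁺ (a ∷ b ∷ c ∷ []) (here d≡a)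
  ∈-tri⁺ (inj₂ (inj₁ d≡b)) = ∈-fromList⁺ (a ∷ b ∷ c ∷ []) (there (here d≡b))
  ∈-tri⁺ (inj₂ (inj₂ d≡c)) = ∈-fromList⁺ (a ∷ b ∷ c ∷ []) (there (there (here d≡c)))

module _ {a b c : Fin n} where

  tri-⊆ : ∀ {S} → a ∈ S → b ∈ S → c ∈ S → tri a b c ⊆ S
  tri-⊆ a∈ b∈ c∈ d∈ with ∈-tri⁻ d∈
  ... | inj₁ refl        = a∈
  ... | inj₂ (inj₁ refl) = b∈
  ... | inj₂ (inj₂ refl) = c∈

  ∣tri∣≡3 : a ≢ b → a ≢ c → b ≢ c → ∣ tri a b c ∣ ≡ 3
  ∣tri∣≡3 a≢b a≢c b≢c =
    ∣p∣≡length ((a≢b ∷ a≢c ∷ []) ∷ (b≢c ∷ []) ∷ [] ∷ [])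
               (∈-fromList⁻ (a ∷ b ∷ c ∷ [])) (∈-fromList⁺ (a ∷ b ∷ c ∷ []))

  ∣tri∣≡3⇒distinct : ∣ tri a b c ∣ ≡ 3 → a ≢ b × a ≢ c × b ≢ c
  ∣tri∣≡3⇒distinct ∣tri∣≡3 =
      (λ { refl → 3≰2 (∣p∣≤length {xs = a ∷ c ∷ []} ([ Any.here , [ Any.here , Any.there ∘ Any.here ]′ ]′ ∘ ∈-tri⁻)) })
    , (λ { refl → 3≰2 (∣p∣≤length {xs = a ∷ b ∷ []} ([ Any.here , [ Any.there ∘ Any.here , Any.here ]′ ]′ ∘ ∈-tri⁻)) })
    , (λ { refl → 3≰2 (∣p∣≤length {xs = a ∷ b ∷ []} ([ Any.here , [ Any.there ∘ Any.here , Any.there ∘ Any.here ]′ ]′ ∘ ∈-tri⁻)) })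
    where
    3≰2 : ¬ ∣ tri a b c ∣ ≤ 2
    3≰2 ≤2 = <-irrefl refl (subst (_≤ 2) ∣tri∣≡3 ≤2)

tri-swap : (a b c : Fin n) → tri a b c ≡ tri a c b
tri-swap a b c = fromList-cong swap swap
  where
  swap : ∀ {x y z d : Fin n} → d ∈ₗ x ∷ y ∷ z ∷ [] → d ∈ₗ x ∷ z ∷ y ∷ []
  swap (here d≡x)                 = here d≡x
  swap (there (here d≡y))         = there (there (here d≡y))
  swap (there (there (here d≡z))) = there (here d≡z)

tri-injective : ∀ {v u w u′ w′ : Fin n} → u Fin.< w → u′ Fin.< w′ → u ≢ v → w ≢ v →
  tri v u w ≡ tri v u′ w′ → u ≡ u′ × w ≡ w′
tri-injective {u = u} {w} u<w u′<w′ u≢v w≢v eq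
  with ∈-tri⁻ (subst (u ∈_) eq (∈-tri⁺ (inj₂ (inj₁ refl)))) | ∈-tri⁻ (subst (w ∈_) eq (∈-tri⁺ (inj₂ (inj₂ refl))))
... | inj₁ u≡v         | _                = contradiction u≡v u≢v
... | _                | inj₁ w≡v         = contradiction w≡v w≢v
... | inj₂ (inj₁ u≡u′) | inj₂ (inj₂ w≡w′) = u≡u′ , w≡w′
... | inj₂ (inj₁ refl) | inj₂ (inj₁ refl) = contradiction u<w (Fin.<-irrefl refl)
... | inj₂ (inj₂ refl) | inj₂ (inj₂ refl) = contradiction u<w (Fin.<-irrefl refl)
... | inj₂ (inj₂ refl) | inj₂ (inj₁ refl) = contradiction u<w (Fin.<-asym u′<w′)

∣p∣≡3⇒tri : ∀ {p : Subset n} → ∣ p ∣ ≡ 3 → ∃[ a ] ∃[ b ] ∃[ c ] p ≡ tri a b c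
∣p∣≡3⇒tri {p = p} ∣p∣≡3 = listed (elements p) (trans (length-elements p) ∣p∣≡3) (sym (fromList-elements p))
  where
  listed : (xs : List (Fin _)) → length xs ≡ 3 → p ≡ fromList xs → ∃[ a ] ∃[ b ] ∃[ c ] p ≡ tri a b c
  listed (a ∷ b ∷ c ∷ []) _ p≡ = a , b , c , p≡

x∉p-x : ∀ {p : Subset n} x → x ∉ p - x
x∉p-x {p = _ ∷ _} zero    ()
x∉p-x {p = _ ∷ _} (suc x) (there x∈) = x∉p-x x x∈

x∈p-y⇒x∈p×x≢y : ∀ {p : Subset n} {x y} → x ∈ p - y → x ∈ p × x ≢ y
x∈p-y⇒x∈p×x≢y {p = p} {y = y} x∈ = p─q⊆p p ⁅ y ⁆ x∈ , λ { refl → x∉p-x y x∈ }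

∣p∣≡1+∣p-x∣ : ∀ {p : Subset n} {x} → x ∈ p → ∣ p ∣ ≡ suc ∣ p - x ∣
∣p∣≡1+∣p-x∣ {p = p} {x} x∈p =
  trans (∣p∣≡length (x∉ ∷ elements-unique (p - x)) p⊆ ⊆p) (cong suc (length-elements (p - x)))
  where
  x∉ : All (x ≢_) (elements (p - x))
  x∉ = All.tabulate λ u∈ x≡u → x∉p-x x (subst (_∈ p - x) (sym x≡u) (∈-elements⁻ u∈))
  p⊆ : ∀ {u} → u ∈ p → u ∈ₗ x ∷ elements (p - x)
  p⊆ {u} u∈p with u ≟ᶠ x
  ... | yes u≡x = here u≡x
  ... | no  u≢x = there (∈-elements⁺ (x∈p∧x≢y⇒x∈p-y u∈p u≢x))
  ⊆p : ∀ {u} → u ∈ₗ x ∷ elements (p - x) → u ∈ p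
  ⊆p (here refl) = x∈p
  ⊆p (there u∈)  = proj₁ (x∈p-y⇒x∈p×x≢y (∈-elements⁻ u∈))

module _ {N : ℕ} (f : Fin n → Fin N) where

  image : Subset n → Subset N
  image S = fromList (map f (elements S))

  ∈-image⁻ : ∀ {S c} → c ∈ image S → ∃[ u ] u ∈ S × c ≡ f u
  ∈-image⁻ {S} c∈ with u , u∈ , c≡fu ← ∈-map⁻ f (∈-fromList⁻ (map f (elements S)) c∈) = u , ∈-elements⁻ u∈ , c≡fu

  image-fromList : (xs : List (Fin n)) → image (fromList xs) ≡ fromList (map f xs)
  image-fromList xs =
    fromList-cong (⊆ₗ.map⁺ f (∈-fromList⁻ xs ∘ ∈-elements⁻)) (⊆ₗ.map⁺ f (∈-elements⁺ ∘ ∈-fromList⁺ xs))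

  InjectiveOn : Subset n → Set
  InjectiveOn S = ∀ {u w} → u ∈ S → w ∈ S → f u ≡ f w → u ≡ w

  injectiveOn? : ∀ S → Dec (InjectiveOn S)
  injectiveOn? S = map′ (λ inj u∈ w∈ → inj _ _ u∈ w∈) (λ inj _ _ → inj)
    (Fin.all? λ u → Fin.all? λ w → u ∈? S →-dec w ∈? S →-dec f u ≟ᶠ f w →-dec u ≟ᶠ w)

  ∣image∣≡∣p∣ : ∀ {p} → InjectiveOn p → ∣ image p ∣ ≡ ∣ p ∣
  ∣image∣≡∣p∣ {p} inj = ≤-antisym
    (≤-trans (∣p∣≤length (∈-fromList⁻ (map f (elements p)))) (≤-reflexive (trans (length-map f (elements p)) (length-elements p))))
    (subst₂ _≤_ (length-elements p) (length-elements (image p))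
      (injectiveOn⇒length≤ f (elements-unique p) (λ u∈ w∈ → inj (∈-elements⁻ u∈) (∈-elements⁻ w∈))
                             (∈-elements⁺ ∘ ∈-fromList⁺ (map f (elements p)) ∘ ∈-map⁺ f)))

  lift-triple : ∀ {S e} → ∣ e ∣ ≡ 3 → e ⊆ image S → ∃[ R ] R ⊆ S × ∣ R ∣ ≡ 3 × image R ≡ e
  lift-triple {S} {e} ∣e∣≡3 e⊆ with ∣p∣≡3⇒tri {p = e} ∣e∣≡3
  ... | a , b , c , refl
    with u , u∈ , refl ← ∈-image⁻ (e⊆ (∈-tri⁺ (inj₁ refl)))
       | v , v∈ , refl ← ∈-image⁻ (e⊆ (∈-tri⁺ (inj₂ (inj₁ refl))))
       | w , w∈ , refl ← ∈-image⁻ (e⊆ (∈-tri⁺ (inj₂ (inj₂ refl))))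
       | fu≢fv , fu≢fw , fv≢fw ← ∣tri∣≡3⇒distinct ∣e∣≡3
    = tri u v w , tri-⊆ u∈ v∈ w∈ , ∣tri∣≡3 (fu≢fv ∘ cong f) (fu≢fw ∘ cong f) (fv≢fw ∘ cong f)
    , image-fromList (u ∷ v ∷ w ∷ [])

allSubsets : ∀ n → List (Subset n)
allSubsets zero    = [] ∷ []
allSubsets (suc n) = cartesianProductWith _∷_ (inside ∷ outside ∷ []) (allSubsets n)

∈-allSubsets : (S : Subset n) → S ∈ₗ allSubsets n
∈-allSubsets []            = here refl
∈-allSubsets (inside ∷ S)  = ∈-cartesianProductWith⁺ _∷_ {xs = inside ∷ outside ∷ []} (here refl) (∈-allSubsets S)
∈-allSubsets (outside ∷ S) = ∈-cartesianProductWith⁺ _∷_ {xs = inside ∷ outside ∷ []} (there (here refl)) (∈-allSubsets S)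

allSubsets-unique : ∀ n → Unique (allSubsets n)
allSubsets-unique zero    = [] ∷ []
allSubsets-unique (suc n) =
  Unique.cartesianProductWith⁺ _∷_ ∷-injective (((λ ()) ∷ []) ∷ [] ∷ []) (allSubsets-unique n)

-- Counting ordered pairs

length-allFin : ∀ n → length (allFin n) ≡ n
length-allFin n = length-tabulate id

pairs : ∀ n → List (Fin n × Fin n)
pairs n = cartesianProduct (allFin n) (allFin n)

∈-pairs : (p : Fin n × Fin n) → p ∈ₗ pairs n
∈-pairs (u , w) = ∈-cartesianProduct⁺ (∈-allFin u) (∈-allFin w)

length-pairs : ∀ n → length (pairs n) ≡ n * n
length-pairs n = trans (length-cartesianProduct (allFin n) (allFin n)) (cong₂ _*_ (length-allFin n) (length-allFin n))

module _ {n : ℕ} where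

  count : {P : Pred (Fin n × Fin n) 0ℓ} → Decidable P → ℕ
  count P? = length (filter P? (pairs n))

  count≤-injection : ∀ {P : Pred (Fin n × Fin n) 0ℓ} (P? : Decidable P) {ys : List Y} (g : Fin n × Fin n → Y) →
    (∀ {p q} → P p → P q → g p ≡ g q → p ≡ q) → (∀ {p} → P p → g p ∈ₗ ys) → count P? ≤ length ys
  count≤-injection P? g inj into = injectiveOn⇒length≤ g
    (Unique.filter⁺ P? (Unique.cartesianProduct⁺ (Unique.allFin⁺ n) (Unique.allFin⁺ n)))
    (λ p∈ q∈ → inj (proj₂ (∈-filter⁻ P? {xs = pairs n} p∈)) (proj₂ (∈-filter⁻ P? {xs = pairs n} q∈)))
    (into ∘ proj₂ ∘ ∈-filter⁻ P? {xs = pairs n})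

  count≤n : ∀ {P : Pred (Fin n × Fin n) 0ℓ} (P? : Decidable P) (g : Fin n × Fin n → Fin n) →
    (∀ {p q} → P p → P q → g p ≡ g q → p ≡ q) → count P? ≤ n
  count≤n P? g inj = subst (count P? ≤_) (length-allFin n) (count≤-injection P? g inj (λ _ → ∈-allFin _))

  module _ {P : Pred (Fin n × Fin n) 0ℓ} (P? : Decidable P) where

    count-universal : (∀ p → P p) → count P? ≡ n * n
    count-universal all = trans (cong length (filter-all P? (All.universal all (pairs n)))) (length-pairs n)

    module _ {Q : Pred (Fin n × Fin n) 0ℓ} (Q? : Decidable Q) where

      count-mono : (∀ {p} → P p → Q p) → count P? ≤ count Q?
      count-mono P⊆Q = count≤-injection P? id (λ _ _ → id) (λ Pp → ∈-filter⁺ Q? (∈-pairs _) (P⊆Q Pp))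

      count-∪ : count (P? ∪? Q?) ≤ count P? + count Q?
      count-∪ = subst (count (P? ∪? Q?) ≤_) (length-++ (filter P? (pairs n)))
        (count≤-injection (P? ∪? Q?) {ys = filter P? (pairs n) ++ filter Q? (pairs n)} id (λ _ _ → id)
          λ { (inj₁ Pp) → ∈-++⁺ˡ (∈-filter⁺ P? (∈-pairs _) Pp)
            ; (inj₂ Qp) → ∈-++⁺ʳ (filter P? (pairs n)) (∈-filter⁺ Q? (∈-pairs _) Qp) })

  Diagonal : Pred (Fin n × Fin n) 0ℓ
  Diagonal (a , b) = a ≡ b

  diagonal? : Decidable Diagonal
  diagonal? (a , b) = a ≟ᶠ b

  Row Column : Fin n → Pred (Fin n × Fin n) 0ℓ
  Row    c (a , _) = a ≡ c
  Column c (_ , b) = b ≡ c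

  row? : ∀ c → Decidable (Row c)
  row? c (a , _) = a ≟ᶠ c

  column? : ∀ c → Decidable (Column c)
  column? c (_ , b) = b ≟ᶠ c

  count-diagonal≤n : count diagonal? ≤ n
  count-diagonal≤n = count≤n diagonal? proj₁ λ { refl refl refl → refl }

  count-row≤n : ∀ c → count (row? c) ≤ n
  count-row≤n c = count≤n (row? c) proj₂ λ { refl refl refl → refl }

  count-column≤n : ∀ c → count (column? c) ≤ n
  count-column≤n c = count≤n (column? c) proj₁ λ { refl refl refl → refl }

-- Links in a 3-graph

module _ {n : ℕ} (G : ThreeGraph n) where

  ∈-edges? : (S : Subset n) → Dec (S ∈ₗ edges G)
  ∈-edges? S = Any.any? (≡-dec _≟_ S) (edges G)

  edge-distinct : ∀ {a b c} → tri a b c ∈ₗ edges G → a ≢ b × a ≢ c × b ≢ c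
  edge-distinct e∈ = ∣tri∣≡3⇒distinct (All.lookup (edges-3 G) e∈)

  Link : Fin n → Pred (Fin n × Fin n) 0ℓ
  Link c (a , b) = tri c a b ∈ₗ edges G

  link? : ∀ c → Decidable (Link c)
  link? c (a , b) = ∈-edges? (tri c a b)

  count-link≤2*degree : ∀ c → count (link? c) ≤ 2 * degree G c
  count-link≤2*degree c = begin
    count (link? c)                      ≤⟨ count-mono (link? c) (ascending? ∪? descending?) split ⟩
    count (ascending? ∪? descending?)    ≤⟨ count-∪ ascending? descending? ⟩
    count ascending? + count descending? ≤⟨ +-mono-≤ (count≤-injection ascending? (λ (a , b) → tri c a b) inj-asc into-asc)
                                                     (count≤-injection descending? (λ (a , b) → tri c b a) inj-desc into-desc) ⟩
    degree G c + degree G c              ≡⟨ cong (λ k → degree G c + k) (+-identityʳ _) ⟨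
    2 * degree G c                       ∎
    where
    open ≤-Reasoning
    Ascending Descending : Pred (Fin n × Fin n) 0ℓ
    Ascending  (a , b) = Link c (a , b) × a Fin.< b
    Descending (a , b) = Link c (a , b) × b Fin.< a

    ascending? : Decidable Ascending
    ascending? (a , b) = link? c (a , b) ×-dec (a Fin.<? b)

    descending? : Decidable Descending
    descending? (a , b) = link? c (a , b) ×-dec (b Fin.<? a)

    split : ∀ {p} → Link c p → (Ascending ∪ Descending) p
    split {a , b} e∈ with Fin.<-cmp a b
    ... | tri< a<b _ _ = inj₁ (e∈ , a<b)
    ... | tri≈ _ a≡b _ = contradiction a≡b (proj₂ (proj₂ (edge-distinct e∈)))
    ... | tri> _ _ b<a = inj₂ (e∈ , b<a)

    inj-asc : ∀ {p q} → Ascending p → Ascending q → tri c (proj₁ p) (proj₂ p) ≡ tri c (proj₁ q) (proj₂ q) → p ≡ q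
    inj-asc (e∈ , a<b) (_ , a′<b′) eq
      with c≢a , c≢b , _ ← edge-distinct e∈
      with refl , refl ← tri-injective a<b a′<b′ (≢-sym c≢a) (≢-sym c≢b) eq
      = refl

    inj-desc : ∀ {p q} → Descending p → Descending q → tri c (proj₂ p) (proj₁ p) ≡ tri c (proj₂ q) (proj₁ q) → p ≡ q
    inj-desc (e∈ , b<a) (_ , b′<a′) eq
      with c≢a , c≢b , _ ← edge-distinct e∈
      with refl , refl ← tri-injective b<a b′<a′ (≢-sym c≢b) (≢-sym c≢a) eq
      = refl

    into-asc : ∀ {p} → Ascending p → tri c (proj₁ p) (proj₂ p) ∈ₗ filter (c ∈?_) (edges G)
    into-asc (e∈ , _) = ∈-filter⁺ (c ∈?_) e∈ (∈-tri⁺ (inj₁ refl))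

    into-desc : ∀ {p} → Descending p → tri c (proj₂ p) (proj₁ p) ∈ₗ filter (c ∈?_) (edges G)
    into-desc {a , b} (e∈ , _) = ∈-filter⁺ (c ∈?_) (subst (_∈ₗ edges G) (tri-swap c a b) e∈) (∈-tri⁺ (inj₁ refl))

  Degenerate : Fin n → Pred (Fin n × Fin n) 0ℓ
  Degenerate c = Diagonal ∪ (Row c ∪ Column c)

  degenerate? : ∀ c → Decidable (Degenerate c)
  degenerate? c = diagonal? ∪? (row? c ∪? column? c)

  Missing : Fin n → Pred (Fin n × Fin n) 0ℓ
  Missing c = ∁ (Link c) ∩ ∁ (Degenerate c)

  missing? : ∀ c → Decidable (Missing c)
  missing? c = ∁? (link? c) ∩? ∁? (degenerate? c)

  count-degenerate≤3n : ∀ c → count (degenerate? c) ≤ 3 * n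
  count-degenerate≤3n c = begin
    count (degenerate? c)                                     ≤⟨ count-∪ (diagonal? {n}) (row? c ∪? column? c) ⟩
    count (diagonal? {n}) + count (row? c ∪? column? c)       ≤⟨ +-monoʳ-≤ (count (diagonal? {n})) (count-∪ (row? c) (column? c)) ⟩
    count (diagonal? {n}) + (count (row? c) + count (column? c))
      ≤⟨ +-mono-≤ (count-diagonal≤n {n}) (+-mono-≤ (count-row≤n c) (count-column≤n c)) ⟩
    n + (n + n)                                               ≡⟨ cong (λ k → n + (n + k)) (+-identityʳ n) ⟨
    3 * n                                                     ∎
    where open ≤-Reasoning

  square≤degree+missing : ∀ c → n * n ≤ 2 * degree G c + 3 * n + count (missing? c)
  square≤degree+missing c = begin
    n * n                                                         ≡⟨ count-universal (link? c ∪? (degenerate? c ∪? missing? c)) cover ⟨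
    count (link? c ∪? (degenerate? c ∪? missing? c))              ≤⟨ count-∪ (link? c) (degenerate? c ∪? missing? c) ⟩
    count (link? c) + count (degenerate? c ∪? missing? c)
      ≤⟨ +-mono-≤ (count-link≤2*degree c) (count-∪ (degenerate? c) (missing? c)) ⟩
    2 * degree G c + (count (degenerate? c) + count (missing? c))
      ≤⟨ +-monoʳ-≤ (2 * degree G c) (+-monoˡ-≤ _ (count-degenerate≤3n c)) ⟩
    2 * degree G c + (3 * n + count (missing? c))                 ≡⟨ +-assoc (2 * degree G c) (3 * n) _ ⟨
    2 * degree G c + 3 * n + count (missing? c)                   ∎
    where
    open ≤-Reasoning
    cover : ∀ p → (Link c ∪ (Degenerate c ∪ Missing c)) p
    cover p with link? c p | degenerate? c p
    ... | yes link | _       = inj₁ link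
    ... | no ¬link | yes deg = inj₂ (inj₁ deg)
    ... | no ¬link | no ¬deg = inj₂ (inj₂ (¬link , ¬deg))

-- The blow-up of H

-- coords u = (colour of u, position of u in its colour class), so every colour class has at most M vertices.
module Construction {N n M : ℕ} (H : ThreeGraph N) (coords : Fin n → Fin N × Fin M)
                    (coords-injective : Injective _≡_ _≡_ coords) (x : Fin n) where

  colour : Fin n → Fin N
  colour = proj₁ ∘ coords

  Edge : Pred (Subset n) 0ℓ
  Edge S = ∣ S ∣ ≡ 3 × (x ∈ S → InjectiveOn colour (S - x)) × (x ∉ S → image colour S ∉ₗ edges H)

  edge? : Decidable Edge
  edge? S = ∣ S ∣ ℕ.≟ 3
    ×-dec (x ∈? S →-dec injectiveOn? colour (S - x))
    ×-dec (¬? (x ∈? S) →-dec ¬? (∈-edges? H (image colour S)))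

  G : ThreeGraph n
  G = record
    { edges    = filter edge? (allSubsets n)
    ; edges-3  = All.map proj₁ (All.all-filter edge? (allSubsets n))
    ; distinct = Unique.filter⁺ edge? (allSubsets-unique n)
    }

  ∈-G⁻ : ∀ {S} → S ∈ₗ edges G → Edge S
  ∈-G⁻ S∈ = proj₂ (∈-filter⁻ edge? {xs = allSubsets n} S∈)

  ∈-G⁺ : ∀ {S} → Edge S → S ∈ₗ edges G
  ∈-G⁺ = ∈-filter⁺ edge? (∈-allSubsets _)

  clique⇒colour-injective : ∀ {K} → x ∈ K → IsClique G K → InjectiveOn colour (K - x)
  clique⇒colour-injective {K} x∈K clique {u} {w} u∈ w∈ fu≡fw
    with u∈K , u≢x ← x∈p-y⇒x∈p×x≢y {p = K} u∈
       | w∈K , w≢x ← x∈p-y⇒x∈p×x≢y {p = K} w∈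
       | u ≟ᶠ w
  ... | yes u≡w = u≡w
  ... | no  u≢w = proj₁ (proj₂ (∈-G⁻ (clique (tri x u w) (∣tri∣≡3 (≢-sym u≢x) (≢-sym w≢x) u≢w)
                                              (tri-⊆ x∈K u∈K w∈K))))
                    (∈-tri⁺ (inj₁ refl))
                    (x∈p∧x≢y⇒x∈p-y (∈-tri⁺ (inj₂ (inj₁ refl))) u≢x)
                    (x∈p∧x≢y⇒x∈p-y (∈-tri⁺ (inj₂ (inj₂ refl))) w≢x)
                    fu≡fw

  x-uncovered : ∀ {t} → (∀ T → ∣ T ∣ ≡ t → SpansEdge H T) → ¬ InCopyOfK (suc t) G x
  x-uncovered {t} spans (K , ∣K∣≡1+t , x∈K , clique) =
    let e , e∈H , e⊆T               = spans (image colour (K - x)) ∣T∣≡t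
        R , R⊆K-x , ∣R∣≡3 , image≡e = lift-triple colour (All.lookup (edges-3 H) e∈H) e⊆T
    in proj₂ (proj₂ (∈-G⁻ (clique R ∣R∣≡3 (proj₁ ∘ x∈p-y⇒x∈p×x≢y {p = K} ∘ R⊆K-x))))
         (x∉p-x {p = K} x ∘ R⊆K-x) (subst (_∈ₗ edges H) (sym image≡e) e∈H)
    where
    ∣T∣≡t : ∣ image colour (K - x) ∣ ≡ t
    ∣T∣≡t = trans (∣image∣≡∣p∣ colour (clique⇒colour-injective x∈K clique))
                  (suc-injective (trans (sym (∣p∣≡1+∣p-x∣ x∈K)) ∣K∣≡1+t))

  missing-at-x : ∀ {p} → Missing G x p → Diagonal (colour (proj₁ p) , colour (proj₂ p))
  missing-at-x {u , w} (¬edge , ¬degenerate) with colour u ≟ᶠ colour w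
  ... | yes fu≡fw = fu≡fw
  ... | no  fu≢fw =
    contradiction (∈-G⁺ (∣tri∣≡3 x≢u x≢w u≢w , (λ _ → pair-injective) , contradiction (∈-tri⁺ (inj₁ refl)))) ¬edge
    where
    u≢w : u ≢ w
    u≢w = ¬degenerate ∘ inj₁
    x≢u : x ≢ u
    x≢u = ≢-sym (¬degenerate ∘ inj₂ ∘ inj₁)
    x≢w : x ≢ w
    x≢w = ≢-sym (¬degenerate ∘ inj₂ ∘ inj₂)
    u-or-w : ∀ {a} → a ∈ tri x u w - x → a ≡ u ⊎ a ≡ w
    u-or-w a∈ with a∈tri , a≢x ← x∈p-y⇒x∈p×x≢y {p = tri x u w} a∈ with ∈-tri⁻ a∈tri
    ... | inj₁ a≡x  = contradiction a≡x a≢x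
    ... | inj₂ u∨w  = u∨w
    pair-injective : InjectiveOn colour (tri x u w - x)
    pair-injective a∈ b∈ fa≡fb with u-or-w a∈ | u-or-w b∈
    ... | inj₁ refl | inj₁ refl = refl
    ... | inj₂ refl | inj₂ refl = refl
    ... | inj₁ refl | inj₂ refl = contradiction fa≡fb fu≢fw
    ... | inj₂ refl | inj₁ refl = contradiction (sym fa≡fb) fu≢fw

  ColourLink : Fin n → Pred (Fin n × Fin n) 0ℓ
  ColourLink v (u , w) = Link H (colour v) (colour u , colour w)

  missing-elsewhere : ∀ {v} → v ≢ x → ∀ {p} → Missing G v p → (Row x ∪ (Column x ∪ ColourLink v)) p
  missing-elsewhere {v} v≢x {u , w} (¬edge , ¬degenerate)
    with u ≟ᶠ x | w ≟ᶠ x | link? H (colour v) (colour u , colour w)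
  ... | yes u≡x | _       | _        = inj₁ u≡x
  ... | no _    | yes w≡x | _        = inj₂ (inj₁ w≡x)
  ... | no _    | no _    | yes link = inj₂ (inj₂ link)
  ... | no u≢x  | no w≢x  | no ¬link =
    contradiction (∈-G⁺ (∣tri∣≡3 v≢u v≢w u≢w , (λ x∈ → contradiction x∈ x∉) , λ _ → image∉H)) ¬edge
    where
    u≢w : u ≢ w
    u≢w = ¬degenerate ∘ inj₁
    v≢u : v ≢ u
    v≢u = ≢-sym (¬degenerate ∘ inj₂ ∘ inj₁)
    v≢w : v ≢ w
    v≢w = ≢-sym (¬degenerate ∘ inj₂ ∘ inj₂)
    x∉ : x ∉ tri v u w
    x∉ = [ ≢-sym v≢x , [ ≢-sym u≢x , ≢-sym w≢x ]′ ]′ ∘ ∈-tri⁻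
    image∉H : image colour (tri v u w) ∉ₗ edges H
    image∉H = subst (_∉ₗ edges H) (sym (image-fromList colour (v ∷ u ∷ w ∷ []))) ¬link

  count-colour-lift : ∀ {P : Pred (Fin n × Fin n) 0ℓ} (P? : Decidable P) {R : Pred (Fin N × Fin N) 0ℓ} (R? : Decidable R) →
    (∀ {p} → P p → R (colour (proj₁ p) , colour (proj₂ p))) → count P? ≤ count R? * (M * M)
  count-colour-lift {P} P? {R} R? P⇒R = subst (count P? ≤_) length-target (count≤-injection P? lift inj into)
    where
    lift : Fin n × Fin n → (Fin N × Fin N) × (Fin M × Fin M)
    lift (u , w) = (proj₁ (coords u) , proj₁ (coords w)) , (proj₂ (coords u) , proj₂ (coords w))
    inj : ∀ {p q} → P p → P q → lift p ≡ lift q → p ≡ q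
    inj _ _ eq = cong₂ _,_ (coords-injective (cong₂ _,_ (cong (proj₁ ∘ proj₁) eq) (cong (proj₁ ∘ proj₂) eq)))
                           (coords-injective (cong₂ _,_ (cong (proj₂ ∘ proj₁) eq) (cong (proj₂ ∘ proj₂) eq)))
    into : ∀ {p} → P p → lift p ∈ₗ cartesianProduct (filter R? (pairs N)) (pairs M)
    into Pp = ∈-cartesianProduct⁺ (∈-filter⁺ R? (∈-pairs _) (P⇒R Pp)) (∈-pairs _)
    length-target : length (cartesianProduct (filter R? (pairs N)) (pairs M)) ≡ count R? * (M * M)
    length-target = trans (length-cartesianProduct (filter R? (pairs N)) (pairs M)) (cong (count R? *_) (length-pairs M))

  degree-x : n * n ≤ 2 * degree G x + 3 * n + N * (M * M)
  degree-x = ≤-trans (square≤degree+missing G x) (+-monoʳ-≤ (2 * degree G x + 3 * n)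
    (≤-trans (count-colour-lift (missing? G x) diagonal? missing-at-x) (*-monoˡ-≤ (M * M) (count-diagonal≤n {N}))))

  degree-elsewhere : ∀ {v d} → v ≢ x → degree H (colour v) ≤ d → n * n ≤ 2 * degree G v + 5 * n + 2 * d * (M * M)
  degree-elsewhere {v} {d} v≢x deg≤d = begin
    n * n                                                        ≤⟨ square≤degree+missing G v ⟩
    2 * degree G v + 3 * n + count (missing? G v)                ≤⟨ +-monoʳ-≤ (2 * degree G v + 3 * n) count-missing ⟩
    2 * degree G v + 3 * n + (n + (n + 2 * d * (M * M)))         ≡⟨ regroup (2 * degree G v) n (2 * d * (M * M)) ⟩
    2 * degree G v + 5 * n + 2 * d * (M * M)                     ∎
    where
    open ≤-Reasoning
    colourLink? : Decidable (ColourLink v)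
    colourLink? (u , w) = link? H (colour v) (colour u , colour w)
    count-missing : count (missing? G v) ≤ n + (n + 2 * d * (M * M))
    count-missing = begin
      count (missing? G v)                                          ≤⟨ count-mono (missing? G v) _ (missing-elsewhere v≢x) ⟩
      count (row? x ∪? (column? x ∪? colourLink?))                  ≤⟨ count-∪ (row? x) _ ⟩
      count (row? x) + count (column? x ∪? colourLink?)             ≤⟨ +-monoʳ-≤ (count (row? x)) (count-∪ (column? x) colourLink?) ⟩
      count (row? x) + (count (column? x) + count colourLink?)
        ≤⟨ +-mono-≤ (count-row≤n x) (+-mono-≤ (count-column≤n x) (count-colour-lift colourLink? (link? H (colour v)) id)) ⟩
      n + (n + count (link? H (colour v)) * (M * M))                ≤⟨ +-monoʳ-≤ n (+-monoʳ-≤ n (*-monoˡ-≤ (M * M)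
                                                                        (≤-trans (count-link≤2*degree H (colour v)) (*-monoʳ-≤ 2 deg≤d)))) ⟩
      n + (n + 2 * d * (M * M))                                     ∎
    regroup : ∀ a n e → a + 3 * n + (n + (n + e)) ≡ a + 5 * n + e
    regroup = solve-∀

module _ (N n : ℕ) .{{_ : NonZero N}} where

  layers : ℕ
  layers = suc (n / N)

  n≤N*layers : n ≤ N * layers
  n≤N*layers = begin
    n                  ≡⟨ m≡m%n+[m/n]*n n N ⟩
    n % N + n / N * N  ≤⟨ +-monoˡ-≤ (n / N * N) (m%n≤n n N) ⟩
    N + n / N * N      ≡⟨ cong (λ k → N + k) (*-comm (n / N) N) ⟩
    N + N * (n / N)    ≡⟨ *-suc N (n / N) ⟨
    N * layers         ∎
    where open ≤-Reasoning

  N*layers≤n+N : N * layers ≤ n + N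
  N*layers≤n+N = begin
    N * layers         ≡⟨ *-suc N (n / N) ⟩
    N + N * (n / N)    ≡⟨ cong (λ k → N + k) (*-comm N (n / N)) ⟩
    N + n / N * N      ≤⟨ +-monoʳ-≤ N (m/n*n≤m n N) ⟩
    N + n              ≡⟨ +-comm N n ⟩
    n + N              ∎
    where open ≤-Reasoning

  coordinates : Fin n → Fin N × Fin layers
  coordinates u = remQuot layers (inject≤ u n≤N*layers)

  coordinates-injective : Injective _≡_ _≡_ coordinates
  coordinates-injective {u} {w} eq = inject≤-injective n≤N*layers n≤N*layers u w (begin
    inject≤ u n≤N*layers                                    ≡⟨ combine-remQuot {N} layers (inject≤ u n≤N*layers) ⟨
    uncurry combine (coordinates u)                         ≡⟨ cong (uncurry combine) eq ⟩
    uncurry combine (coordinates w)                         ≡⟨ combine-remQuot {N} layers (inject≤ w n≤N*layers) ⟩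
    inject≤ w n≤N*layers                                    ∎)
    where open ≡-Reasoning

-- Asymptotics

m*m≡2[mC2]+m : ∀ m → m * m ≡ 2 * (m C 2) + m
m*m≡2[mC2]+m zero    = refl
m*m≡2[mC2]+m (suc m) = begin
  suc m * suc m                ≡⟨ expand m ⟩
  m * m + 2 * m + 1            ≡⟨ cong (λ k → k + 2 * m + 1) (m*m≡2[mC2]+m m) ⟩
  2 * (m C 2) + m + 2 * m + 1  ≡⟨ regroup (m C 2) m ⟩
  2 * (m + m C 2) + suc m      ≡⟨ cong (λ k → 2 * (k + m C 2) + suc m) (nC1≡n m) ⟨
  2 * (m C 1 + m C 2) + suc m  ≡⟨ cong (λ k → 2 * k + suc m) (nCk+nC[k+1]≡[n+1]C[k+1] m 1) ⟩
  2 * (suc m C 2) + suc m      ∎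
  where
  open ≡-Reasoning
  expand : ∀ m → suc m * suc m ≡ m * m + 2 * m + 1
  expand = solve-∀
  regroup : ∀ c m → 2 * c + m + 2 * m + 1 ≡ 2 * (m + c) + suc m
  regroup = solve-∀

linear≤2[mC2] : ∀ K m → 2 * K < m → K * suc m ≤ 2 * (m C 2)
linear≤2[mC2] K m@(suc _) 2K<m = +-cancelʳ-≤ m _ _ (begin
  K * suc m + m    ≡⟨ split K m ⟩
  K + K * m + m    ≤⟨ +-monoˡ-≤ m (+-monoˡ-≤ (K * m) (m≤m*n K m)) ⟩
  K * m + K * m + m ≡⟨ merge K m ⟩
  suc (2 * K) * m  ≤⟨ *-monoˡ-≤ m 2K<m ⟩
  m * m            ≡⟨ m*m≡2[mC2]+m m ⟩
  2 * (m C 2) + m  ∎)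
  where
  open ≤-Reasoning
  split : ∀ K m → K * suc m + m ≡ K + K * m + m
  split = solve-∀
  merge : ∀ K m → K * m + K * m + m ≡ suc (2 * K) * m
  merge = solve-∀

QuadraticBound : (a b c n D : ℕ) → Set
QuadraticBound a b c n D = b * (n * n) ≤ a * (n * n) + b * (2 * D) + c * n

rescale : ∀ {n N M D k e s t} .{{_ : NonZero n}} → N * M ≤ n + N → s * e ≡ t * (N * N) →
  n * n ≤ 2 * D + k * n + e * (M * M) → QuadraticBound t s (s * k + 2 * t * N + t * (N * N)) n D
rescale {n} {N} {M} {D} {k} {e} {s} {t} NM≤n+N se≡tNN h = begin
  s * (n * n)                                                         ≤⟨ *-monoʳ-≤ s h ⟩
  s * (2 * D + k * n + e * (M * M))                                   ≡⟨ expand s D k n e M ⟩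
  s * (2 * D) + s * k * n + s * e * (M * M)                           ≡⟨ cong (λ z → s * (2 * D) + s * k * n + z * (M * M)) se≡tNN ⟩
  s * (2 * D) + s * k * n + t * (N * N) * (M * M)                     ≡⟨ cong (λ z → s * (2 * D) + s * k * n + z) (pair-up t N M) ⟩
  s * (2 * D) + s * k * n + t * (N * M * (N * M))
    ≤⟨ +-monoʳ-≤ (s * (2 * D) + s * k * n) (*-monoʳ-≤ t (*-mono-≤ NM≤n+N NM≤n+N)) ⟩
  s * (2 * D) + s * k * n + t * ((n + N) * (n + N))                   ≡⟨ expand′ s D k n t N ⟩
  t * (n * n) + s * (2 * D) + (s * k + 2 * t * N) * n + t * (N * N)     ≤⟨ +-monoʳ-≤ _ (m≤m*n (t * (N * N)) n) ⟩
  t * (n * n) + s * (2 * D) + (s * k + 2 * t * N) * n + t * (N * N) * n ≡⟨ collect t n s D k N ⟩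
  t * (n * n) + s * (2 * D) + (s * k + 2 * t * N + t * (N * N)) * n     ∎
  where
  open ≤-Reasoning
  expand : ∀ s D k n e M → s * (2 * D + k * n + e * (M * M)) ≡ s * (2 * D) + s * k * n + s * e * (M * M)
  expand = solve-∀
  pair-up : ∀ t N M → t * (N * N) * (M * M) ≡ t * (N * M * (N * M))
  pair-up = solve-∀
  expand′ : ∀ s D k n t N → s * (2 * D) + s * k * n + t * ((n + N) * (n + N)) ≡
                            t * (n * n) + s * (2 * D) + (s * k + 2 * t * N) * n + t * (N * N)
  expand′ = solve-∀
  collect : ∀ t n s D k N → t * (n * n) + s * (2 * D) + (s * k + 2 * t * N) * n + t * (N * N) * n ≡
                            t * (n * n) + s * (2 * D) + (s * k + 2 * t * N + t * (N * N)) * n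
  collect = solve-∀

-- The conclusion is (1 - a/b - 1/q)·C(m, 2) ≤ D with the denominators cleared.
density-ℕ : ∀ a b c q m D .{{_ : NonZero b}} → 2 * (q * (3 * a + c)) < m → QuadraticBound a b c (suc m) D →
  b * q * (m C 2) ≤ a * q * (m C 2) + b * (m C 2) + b * q * D
density-ℕ a b c q m D large h = *-cancelˡ-≤ 2 (begin
  2 * (b * q * B)                                                   ≡⟨ double b q B ⟩
  q * (b * (2 * B))                                                 ≤⟨ *-monoʳ-≤ q drop-lower-terms ⟩
  q * (a * (2 * B) + b * (2 * D) + (3 * a + c) * suc m)             ≡⟨ distribute q (a * (2 * B)) (b * (2 * D)) (3 * a + c) (suc m) ⟩
  q * (a * (2 * B)) + q * (b * (2 * D)) + q * (3 * a + c) * suc m   ≤⟨ +-monoʳ-≤ (q * (a * (2 * B)) + q * (b * (2 * D)))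
                                                                         (≤-trans (linear≤2[mC2] (q * (3 * a + c)) m large) (m≤n*m (2 * B) b)) ⟩
  q * (a * (2 * B)) + q * (b * (2 * D)) + b * (2 * B)               ≡⟨ halve q a b B D ⟩
  2 * (a * q * B + b * B + b * q * D)                               ∎)
  where
  open ≤-Reasoning
  B : ℕ
  B = m C 2
  square≡ : suc m * suc m ≡ 2 * B + (3 * m + 1)
  square≡ = trans (expand m) (trans (cong (λ k → k + (2 * m + 1)) (m*m≡2[mC2]+m m)) (regroup B m))
    where
    expand : ∀ m → suc m * suc m ≡ m * m + (2 * m + 1)
    expand = solve-∀
    regroup : ∀ B m → 2 * B + m + (2 * m + 1) ≡ 2 * B + (3 * m + 1)
    regroup = solve-∀
  drop-lower-terms : b * (2 * B) ≤ a * (2 * B) + b * (2 * D) + (3 * a + c) * suc m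
  drop-lower-terms = begin
    b * (2 * B)                                           ≤⟨ *-monoʳ-≤ b (m≤m+n (2 * B) (3 * m + 1)) ⟩
    b * (2 * B + (3 * m + 1))                             ≡⟨ cong (b *_) square≡ ⟨
    b * (suc m * suc m)                                   ≤⟨ h ⟩
    a * (suc m * suc m) + b * (2 * D) + c * suc m         ≡⟨ cong (λ k → a * k + b * (2 * D) + c * suc m) square≡ ⟩
    a * (2 * B + (3 * m + 1)) + b * (2 * D) + c * suc m   ≤⟨ +-monoˡ-≤ (c * suc m) (+-monoˡ-≤ (b * (2 * D))
                                                               (*-monoʳ-≤ a (+-monoʳ-≤ (2 * B) (+-monoʳ-≤ (3 * m) (s≤s (z≤n {2})))))) ⟩
    a * (2 * B + (3 * m + 3)) + b * (2 * D) + c * suc m   ≡⟨ collect a B m b D c ⟩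
    a * (2 * B) + b * (2 * D) + (3 * a + c) * suc m       ∎
    where
    collect : ∀ a B m b D c → a * (2 * B + (3 * m + 3)) + b * (2 * D) + c * suc m ≡ a * (2 * B) + b * (2 * D) + (3 * a + c) * suc m
    collect = solve-∀
  double : ∀ b q B → 2 * (b * q * B) ≡ q * (b * (2 * B))
  double = solve-∀
  distribute : ∀ q x y z s → q * (x + y + z * s) ≡ q * x + q * y + q * z * s
  distribute = solve-∀
  halve : ∀ q a b B D → q * (a * (2 * B)) + q * (b * (2 * D)) + b * (2 * B) ≡ 2 * (a * q * B + b * B + b * q * D)
  halve = solve-∀

toℚᵘ-/ : ∀ i n → toℚᵘ (i ℚ./ suc n) ℚᵘ.≃ mkℚᵘ i n
toℚᵘ-/ i n = ℚP.toℚᵘ-fromℚᵘ (mkℚᵘ i n)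

toℚᵘ-homo-− : ∀ p q → toℚᵘ (p ℚ.- q) ℚᵘ.≃ toℚᵘ p ℚᵘ.- toℚᵘ q
toℚᵘ-homo-− p q = ℚᵘP.≃-trans (ℚP.toℚᵘ-homo-+ p (ℚ.- q)) (ℚᵘP.+-congʳ (toℚᵘ p) (ℚP.toℚᵘ-homo‿- q))

archimedean : ∀ ε → 0ℚ ℚ.< ε → ∃[ q ] + 1 ℚ./ suc q ℚ.≤ ε
archimedean (mkℚ +[1+ p ] q _) _ =
  q , ℚP.toℚᵘ-cancel-≤
        (ℚᵘP.≤-respˡ-≃ (ℚᵘP.≃-sym (toℚᵘ-/ (+ 1) q)) (*≤* (+≤+ (*-monoˡ-≤ (suc q) (s≤s (z≤n {p}))))))
archimedean (mkℚ (+ 0)    _ _) (ℚ.*<* (ℤ.+<+ ()))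
archimedean (mkℚ -[1+ _ ] _ _) (ℚ.*<* ())

pos-*³ : ∀ x y z → + (x * y * z) ≡ + x ℤ.* + y ℤ.* + z
pos-*³ x y z = trans (ℤP.pos-* (x * y) z) (cong (ℤ._* + z) (ℤP.pos-* x y))

-- The left-hand side is the numerator of ((1 - A/b) - 1/q)·B as ℚᵘ arithmetic computes it; its denominator
-- involves b′ = 1 · b, which is b only propositionally.
cross-multiplied : ∀ A b b′ q B D → b′ ≡ b →
  b ℤ.* q ℤ.* B ℤ.≤ A ℤ.* q ℤ.* B ℤ.+ b ℤ.* B ℤ.+ b ℤ.* q ℤ.* D →
  ((+ 1 ℤ.* b ℤ.+ ℤ.- A ℤ.* + 1) ℤ.* q ℤ.+ -[1+ 0 ] ℤ.* b′) ℤ.* B ℤ.* + 1 ℤ.≤ D ℤ.* (b′ ℤ.* q ℤ.* + 1)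
cross-multiplied A b .b q B D refl h = begin
  ((+ 1 ℤ.* b ℤ.+ ℤ.- A ℤ.* + 1) ℤ.* q ℤ.+ -[1+ 0 ] ℤ.* b) ℤ.* B ℤ.* + 1    ≡⟨ numerator A b q B ⟩
  b ℤ.* q ℤ.* B ℤ.- (A ℤ.* q ℤ.* B ℤ.+ b ℤ.* B)                                ≤⟨ ℤP.+-monoˡ-≤ _ h ⟩
  A ℤ.* q ℤ.* B ℤ.+ b ℤ.* B ℤ.+ b ℤ.* q ℤ.* D ℤ.- (A ℤ.* q ℤ.* B ℤ.+ b ℤ.* B)
    ≡⟨ cancel (A ℤ.* q ℤ.* B ℤ.+ b ℤ.* B) b q D ⟩
  D ℤ.* (b ℤ.* q ℤ.* + 1)                                                       ∎
  where
  open ℤP.≤-Reasoning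
  numerator : ∀ A b q B → ((+ 1 ℤ.* b ℤ.+ ℤ.- A ℤ.* + 1) ℤ.* q ℤ.+ -[1+ 0 ] ℤ.* b) ℤ.* B ℤ.* + 1 ≡
                          b ℤ.* q ℤ.* B ℤ.- (A ℤ.* q ℤ.* B ℤ.+ b ℤ.* B)
  numerator = ℤ-Solver.solve-∀
  cancel : ∀ X b q D → X ℤ.+ b ℤ.* q ℤ.* D ℤ.- X ≡ D ℤ.* (b ℤ.* q ℤ.* + 1)
  cancel = ℤ-Solver.solve-∀

density-ℚ : ∀ {α ε} a b q B D .{{_ : NonZero b}} .{{_ : NonZero q}} →
  α ℚ.≤ 1ℚ ℚ.- + a ℚ./ b → + 1 ℚ./ q ℚ.≤ ε →
  b * q * B ≤ a * q * B + b * B + b * q * D →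
  (α ℚ.- ε) ℚ.* toℚ B ℚ.≤ toℚ D
density-ℚ {α} {ε} a (suc b) (suc q) B D α≤ ε≥ h = begin
  (α ℚ.- ε) ℚ.* toℚ B
    ≤⟨ ℚP.*-monoʳ-≤-nonNeg (toℚ B) {{ℚP.normalize-nonNeg B 1}} (ℚP.+-mono-≤ α≤ (ℚP.neg-antimono-≤ ε≥)) ⟩
  r ℚ.* toℚ B
    ≤⟨ ℚP.toℚᵘ-cancel-≤ (ℚᵘP.≤-respˡ-≃ (ℚᵘP.≃-sym r*B≃) (ℚᵘP.≤-respʳ-≃ (ℚᵘP.≃-sym (toℚᵘ-/ (+ D) 0)) r*B≤D)) ⟩
  toℚ D                ∎
  where
  open ℚP.≤-Reasoning
  r : ℚ
  r = (1ℚ ℚ.- + a ℚ./ suc b) ℚ.- + 1 ℚ./ suc q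
  r*B≃ : toℚᵘ (r ℚ.* toℚ B) ℚᵘ.≃ ((1ℚᵘ ℚᵘ.- mkℚᵘ (+ a) b) ℚᵘ.- mkℚᵘ (+ 1) q) ℚᵘ.* mkℚᵘ (+ B) 0
  r*B≃ = ℚᵘP.≃-trans (ℚP.toℚᵘ-homo-* r (toℚ B)) (ℚᵘP.*-cong
    (ℚᵘP.≃-trans (toℚᵘ-homo-− (1ℚ ℚ.- + a ℚ./ suc b) (+ 1 ℚ./ suc q)) (ℚᵘP.+-cong
      (ℚᵘP.≃-trans (toℚᵘ-homo-− 1ℚ (+ a ℚ./ suc b)) (ℚᵘP.+-cong (toℚᵘ-/ (+ 1) 0) (ℚᵘP.-‿cong (toℚᵘ-/ (+ a) b))))
      (ℚᵘP.-‿cong (toℚᵘ-/ (+ 1) q))))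
    (toℚᵘ-/ (+ B) 0))
  h′ : + suc b ℤ.* + suc q ℤ.* + B ℤ.≤ + a ℤ.* + suc q ℤ.* + B ℤ.+ + suc b ℤ.* + B ℤ.+ + suc b ℤ.* + suc q ℤ.* + D
  h′ = subst₂ ℤ._≤_ (pos-*³ (suc b) (suc q) B)
    (trans (ℤP.pos-+ (a * suc q * B + suc b * B) _) (cong₂ ℤ._+_
      (trans (ℤP.pos-+ (a * suc q * B) _) (cong₂ ℤ._+_ (pos-*³ a (suc q) B) (ℤP.pos-* (suc b) B)))
      (pos-*³ (suc b) (suc q) D)))
    (+≤+ h)
  r*B≤D : ((1ℚᵘ ℚᵘ.- mkℚᵘ (+ a) b) ℚᵘ.- mkℚᵘ (+ 1) q) ℚᵘ.* mkℚᵘ (+ B) 0 ℚᵘ.≤ mkℚᵘ (+ D) 0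
  r*B≤D = *≤* (cross-multiplied (+ a) (+ suc b) (+ (1 * suc b)) (+ suc q) (+ B) (+ D) (cong +_ (*-identityˡ (suc b))) h′)

Eventually : (ℕ → Set) → Set
Eventually P = ∃[ m₀ ] ∀ m → m₀ ≤ m → P m

eventually-× : ∀ {P Q : ℕ → Set} → Eventually P → Eventually Q → Eventually (λ m → P m × Q m)
eventually-× (m₀ , p) (m₁ , q) =
  m₀ ⊔ m₁ , λ m ≤m → p m (≤-trans (m≤m⊔n m₀ m₁) ≤m) , q m (≤-trans (m≤n⊔m m₀ m₁) ≤m)

eventually-density : ∀ a b c {α ε} q .{{_ : NonZero b}} → α ℚ.≤ 1ℚ ℚ.- + a ℚ./ b → + 1 ℚ./ suc q ℚ.≤ ε →
  Eventually (λ m → ∀ D → QuadraticBound a b c (suc m) D → (α ℚ.- ε) ℚ.* toℚ (m C 2) ℚ.≤ toℚ D)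
eventually-density a b c q α≤ ε≥ = suc (2 * (suc q * (3 * a + c))) , λ m large D h →
  density-ℚ a b (suc q) (m C 2) D α≤ ε≥ (density-ℕ a b c (suc q) m D large h)

bound≤1-1/N : ∀ n d → bound (suc n) d ℚ.≤ 1ℚ ℚ.- + 1 ℚ./ suc n
bound≤1-1/N n d = ℚP.p⊓q≤p (1ℚ ℚ.- + 1 ℚ./ suc n) (1ℚ ℚ.- + (2 * d) ℚ./ (suc n * suc n))

bound≤1-2d/N² : ∀ n d → bound (suc n) d ℚ.≤ 1ℚ ℚ.- + (2 * d) ℚ./ (suc n * suc n)
bound≤1-2d/N² n d = ℚP.p⊓q≤q (1ℚ ℚ.- + 1 ℚ./ suc n) (1ℚ ℚ.- + (2 * d) ℚ./ (suc n * suc n))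

-- The linear coefficients produced by rescale at x (s = N, k = 3, t = 1) and elsewhere (s = N², k = 5, t = 2d).
cₓ : ℕ → ℕ
cₓ N = N * 3 + 2 * 1 * N + 1 * (N * N)

cᵥ : ℕ → ℕ → ℕ
cᵥ N d = N * N * 5 + 2 * (2 * d) * N + 2 * d * (N * N)

module _ {N t d : ℕ} .{{_ : NonZero N}} (H : ThreeGraph N) (deg≤d : ∀ v → degree H v ≤ d)
         (spans : ∀ S → ∣ S ∣ ≡ t → SpansEdge H S) where

  blow-up-witness : ∀ {α} m →
    (∀ D → QuadraticBound 1 N (cₓ N) (suc m) D → α ℚ.* toℚ (m C 2) ℚ.≤ toℚ D) ×
    (∀ D → QuadraticBound (2 * d) (N * N) (cᵥ N d) (suc m) D → α ℚ.* toℚ (m C 2) ℚ.≤ toℚ D) →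
    c₁AtLeast (suc m) (suc t) α
  blow-up-witness {α} m (density-at-x , density-elsewhere) = G , (λ covering → x-uncovered spans (covering zero)) , degree≥
    where
    open Construction H (coordinates N (suc m)) (coordinates-injective N (suc m)) zero
    -- case rather than with: abstracting over v ≟ᶠ zero makes Agda normalise degree G v, which is very costly.
    degree≥ : ∀ v → α ℚ.* toℚ (m C 2) ℚ.≤ toℚ (degree G v)
    degree≥ v = case v ≟ᶠ zero of λ where
      (yes refl) → density-at-x (degree G zero)
        (rescale {D = degree G zero} {k = 3} {e = N} {s = N} {t = 1} (N*layers≤n+N N (suc m)) (sym (*-identityˡ (N * N))) degree-x)
      (no  v≢x)  → density-elsewhere (degree G v)
        (rescale {D = degree G v} {k = 5} {e = 2 * d} {s = N * N} {t = 2 * d} (N*layers≤n+N N (suc m)) (*-comm (N * N) (2 * d))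
                 (degree-elsewhere v≢x (deg≤d (colour v))))

-- N = 0 is excluded by coverage through its NonZero instance.
proposition2p7 : (t N d : ℕ) → .{{_ : NonZero t}} → .{{_ : NonZero N}} → .{{_ : NonZero d}} →
    (H : ThreeGraph N) →
    (∀ v → degree H v ≤ d) →
    (∀ S → ∣ S ∣ ≡ t → SpansEdge H S) →
    c₁KAtLeast (suc t) (bound N d)
proposition2p7 t N@(suc n) d H deg≤d spans ε ε>0 =
  let q , 1/q≤ε   = archimedean ε ε>0
      m₀ , dense = eventually-× (eventually-density 1 N (cₓ N) q (bound≤1-1/N n d) 1/q≤ε)
                                (eventually-density (2 * d) (N * N) (cᵥ N d) q (bound≤1-2d/N² n d) 1/q≤ε)
  in suc m₀ , λ { (suc m) (s≤s m₀≤m) → blow-up-witness H deg≤d spans {α = bound N d ℚ.- ε} m (dense m m₀≤m) }
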